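{- Let $G=(V,E)$ be a finite simple graph with $\#V=n$, and for $A\subseteq V$ let $E(A)$ be the set of edges with both endpoints in $A$. Then the chromatic number of $G$ satisfies $$\gamma(G)=\min_{(A_1,\dots,A_n)\in\mathcal P(V)^n}\Big\{n\sum_{i=1}^n\#E(A_i)+\sum_{i=1}^n\mathrm{sgn}(\#A_i)+n\Big(n-\#\bigcup_{i=1}^nA_i\Big)\Big\}.$$
   Context: $\mathcal P(V)^n$ is the set of $n$-tuples of (not necessarily disjoint) subsets of $V$; $\mathrm{sgn}(\#A)=1$ if $A\ne\varnothing$ and $0$ otherwise. -}

module Defs where

open import Data.Bool using (Bool; true; false; if_then_else_; _∧_)
open import Data.Nat using (ℕ; zero; suc; _+_; _*_; _∸_; _≤_)
open import Data.Fin using (Fin; toℕ)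
open import Data.Fin.Subset using (Subset; ⋃; ∣_∣; inside)
open import Data.List using (List; map; allFin; tabulate)
open import Data.Nat.ListAction using (sum)
open import Data.Vec using (lookup)
open import Data.Product using (Σ; _×_)
open import Relation.Binary.PropositionalEquality using (_≡_; _≢_)
open import Relation.Nullary using (¬_; does)
open import Data.Fin using (_<?_)
open import Data.Bool using () renaming (_≟_ to _≟ᴮ_)

record SimpleGraph (n : ℕ) : Set where
  field
    Adj    : Fin n → Fin n → Bool
    sym    : ∀ u v → Adj u v ≡ Adj v u
    irrefl : ∀ v → Adj v v ≡ false
open SimpleGraph public

IsProperColouring : ∀ {n} → SimpleGraph n → (k : ℕ) → (Fin n → Fin k) → Set
IsProperColouring G k c = ∀ u v → Adj G u v ≡ true → c u ≢ c v

Colourable : ∀ {n} → SimpleGraph n → ℕ → Set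
Colourable {n} G k = Σ (Fin n → Fin k) (IsProperColouring G k)

IsChromaticNumber : ∀ {n} → SimpleGraph n → ℕ → Set
IsChromaticNumber G γ = Colourable G γ × (∀ k → Colourable G k → γ ≤ k)

mem : ∀ {n} → Fin n → Subset n → Bool
mem v A = does (lookup A v ≟ᴮ inside)

-- #E(A): number of edges {u,v} (counted once, via toℕ u < toℕ v) with both ends in A
edgeCount : ∀ {n} → SimpleGraph n → Subset n → ℕ
edgeCount {n} G A =
  sum (map (λ u → sum (map (λ v →
    if does (u <? v) ∧ Adj G u v ∧ mem u A ∧ mem v A then 1 else 0)
    (allFin n))) (allFin n))

sgn : ℕ → ℕ
sgn zero    = 0
sgn (suc _) = 1

objective : ∀ {n} → SimpleGraph n → (Fin n → Subset n) → ℕ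
objective {n} G A =
  n * sum (tabulate (λ i → edgeCount G (A i)))
  + sum (tabulate (λ i → sgn ∣ A i ∣))
  + n * (n ∸ ∣ ⋃ (tabulate A) ∣)

IsMinObjective : ∀ {n} → SimpleGraph n → ℕ → Set
IsMinObjective {n} G m =
  Σ (Fin n → Subset n) (λ A → objective G A ≡ m)
  × (∀ (A : Fin n → Subset n) → m ≤ objective G A)

-- The colour classes of an optimal colouring, padded with empty sets, are independent, cover V and
-- exactly γ of them are nonempty, so they attain the value γ. Conversely, a tuple with an edge inside
-- some Aᵢ or an uncovered vertex costs at least n ≥ γ; otherwise the Aᵢ cover V by independent sets,
-- and colouring each vertex by some Aᵢ containing it, renumbering the nonempty Aᵢ consecutively,
-- is a proper colouring with Σ sgn #Aᵢ colours.
module Submission where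

open import Defs renaming (sym to Adj-sym)
open import Data.Bool using (true; false; _∧_; if_then_else_) renaming (_≟_ to _≟ᵇ_)
open import Data.Empty using (⊥; ⊥-elim)
open import Data.Fin using (Fin; zero; suc; toℕ; inject≤; _<?_) renaming (_<_ to _<ᶠ_; _≟_ to _≟ᶠ_)
open import Data.Fin.Properties
  using (suc-injective; <-cmp; toℕ<n; toℕ-inject≤; inject≤-injective)
open import Data.Fin.Subset using (Subset; _∈_; ⋃; ∣_∣)
open import Data.Fin.Subset.Properties
  using (x∈p∪q⁻; x∈p∪q⁺; ∉⊥; ∈⊤; ∣⊤∣≡n; ∣p∣≡n⇒p≡⊤; ∣p∣≤n; ⊆-antisym; Empty-unique; ∣⊥∣≡0;
         x∈p⇒∣p-x∣<∣p∣)
open import Data.List using (map; allFin; tabulate)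
open import Data.List.Properties using (map-tabulate; tabulate-cong)
open import Data.Nat using (ℕ; zero; suc; _+_; _*_; _∸_; _≤_; _<_; z≤n; s≤s)
open import Data.Nat.ListAction using (sum)
open import Data.Nat.Properties
  using (m+n≡0⇒m≡0; m+n≡0⇒n≡0; +-mono-≤; ≤-trans; ≤-antisym; m≤m+n; m≤n+m; m≤m*n;
         *-zeroʳ; +-identityʳ; m<n⇒n≢0; m∸n≡0⇒m≤n; n∸n≡0; <⇒≱; module ≤-Reasoning)
open import Data.Product using (∃; _,_; proj₁; proj₂)
open import Data.Sum using (inj₁; inj₂)
open import Data.Vec using (lookup)
open import Data.Vec.Properties using ([]=⇒lookup; lookup⇒[]=; lookup∘tabulate)
import Data.Vec as Vec
open import Function using (_∘_)
open import Relation.Binary.Definitions using (tri<; tri≈; tri>)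
open import Relation.Binary.PropositionalEquality
open import Relation.Nullary using (does; yes; no)
open import Relation.Nullary.Decidable using (dec-true)

sum-tabulate≡0⁻ : ∀ {m} (f : Fin m → ℕ) → sum (tabulate f) ≡ 0 → ∀ i → f i ≡ 0
sum-tabulate≡0⁻ f Σf≡0 zero    = m+n≡0⇒m≡0 (f zero) Σf≡0
sum-tabulate≡0⁻ f Σf≡0 (suc i) = sum-tabulate≡0⁻ (f ∘ suc) (m+n≡0⇒n≡0 (f zero) Σf≡0) i

sum-tabulate≡0⁺ : ∀ {m} (f : Fin m → ℕ) → (∀ i → f i ≡ 0) → sum (tabulate f) ≡ 0
sum-tabulate≡0⁺ {zero}  f f≡0 = refl
sum-tabulate≡0⁺ {suc m} f f≡0 rewrite f≡0 zero = sum-tabulate≡0⁺ (f ∘ suc) (f≡0 ∘ suc)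

sum-tabulate-≤ : ∀ {m} k (f : Fin m → ℕ) → (∀ i → f i ≤ 1) → (∀ i → k ≤ toℕ i → f i ≡ 0) →
                 sum (tabulate f) ≤ k
sum-tabulate-≤ {zero}  k       f f≤1 f≡0 = z≤n
sum-tabulate-≤ {suc m} zero    f f≤1 f≡0 rewrite f≡0 zero z≤n =
  sum-tabulate-≤ zero (f ∘ suc) (f≤1 ∘ suc) (λ i _ → f≡0 (suc i) z≤n)
sum-tabulate-≤ {suc m} (suc k) f f≤1 f≡0 =
  +-mono-≤ (f≤1 zero) (sum-tabulate-≤ k (f ∘ suc) (f≤1 ∘ suc) (λ i k≤i → f≡0 (suc i) (s≤s k≤i)))

sgn≤1 : ∀ m → sgn m ≤ 1
sgn≤1 zero    = z≤n
sgn≤1 (suc _) = s≤s z≤n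

k≤n*E+S+n*D : ∀ {k} n E S D → k ≤ n → (E ≡ 0 → D ≡ 0 → k ≤ S) → k ≤ n * E + S + n * D
k≤n*E+S+n*D n (suc e) S D k≤n _ =
  ≤-trans k≤n (≤-trans (m≤m*n n (suc e)) (≤-trans (m≤m+n (n * suc e) S) (m≤m+n _ (n * D))))
k≤n*E+S+n*D n zero S (suc d) k≤n _ =
  ≤-trans k≤n (≤-trans (m≤m*n n (suc d)) (m≤n+m (n * suc d) (n * 0 + S)))
k≤n*E+S+n*D n zero S zero _ k≤S rewrite *-zeroʳ n | +-identityʳ S = k≤S refl refl

n*0+S+n*0≡S : ∀ n S → n * 0 + S + n * 0 ≡ S
n*0+S+n*0≡S n S rewrite *-zeroʳ n = +-identityʳ S

∈⋃⁻ : ∀ {m n} (A : Fin m → Subset n) {v} → v ∈ ⋃ (tabulate A) → ∃ λ i → v ∈ A i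
∈⋃⁻ {zero}  A v∈⊥ = ⊥-elim (∉⊥ v∈⊥)
∈⋃⁻ {suc m} A v∈⋃ with x∈p∪q⁻ (A zero) (⋃ (tabulate (A ∘ suc))) v∈⋃
... | inj₁ v∈A₀ = zero , v∈A₀
... | inj₂ v∈⋃′ = let i , v∈Aᵢ = ∈⋃⁻ (A ∘ suc) v∈⋃′ in suc i , v∈Aᵢ

∈⋃⁺ : ∀ {m n} (A : Fin m → Subset n) {v} i → v ∈ A i → v ∈ ⋃ (tabulate A)
∈⋃⁺ {suc m} A zero    v∈A₀ = x∈p∪q⁺ (inj₁ v∈A₀)
∈⋃⁺ {suc m} A (suc i) v∈Aᵢ = x∈p∪q⁺ (inj₂ (∈⋃⁺ (A ∘ suc) i v∈Aᵢ))

n∸∣p∣≡0⇒∈ : ∀ {n} (p : Subset n) → n ∸ ∣ p ∣ ≡ 0 → ∀ v → v ∈ p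
n∸∣p∣≡0⇒∈ p n∸∣p∣≡0 v =
  subst (v ∈_) (sym (∣p∣≡n⇒p≡⊤ (≤-antisym (∣p∣≤n p) (m∸n≡0⇒m≤n n∸∣p∣≡0)))) ∈⊤

∈⇒n∸∣p∣≡0 : ∀ {n} (p : Subset n) → (∀ v → v ∈ p) → n ∸ ∣ p ∣ ≡ 0
∈⇒n∸∣p∣≡0 {n} p ∈p rewrite ⊆-antisym (λ _ → ∈⊤) (λ {v} _ → ∈p v) | ∣⊤∣≡n n = n∸n≡0 n

∈⇒∣p∣≢0 : ∀ {n} {p : Subset n} {v} → v ∈ p → ∣ p ∣ ≢ 0
∈⇒∣p∣≢0 v∈p = m<n⇒n≢0 (x∈p⇒∣p-x∣<∣p∣ v∈p)

mem≡true⇒∈ : ∀ {n} {v : Fin n} (p : Subset n) → mem v p ≡ true → v ∈ p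
mem≡true⇒∈ {v = v} p mem≡true = lookup⇒[]= v p (lookup≡true (lookup p v) mem≡true)
  where
  lookup≡true : ∀ b → does (b ≟ᵇ true) ≡ true → b ≡ true
  lookup≡true true  _ = refl
  lookup≡true false ()

∈⇒mem≡true : ∀ {n} {v : Fin n} {p : Subset n} → v ∈ p → mem v p ≡ true
∈⇒mem≡true v∈p rewrite []=⇒lookup v∈p = refl

Independent : ∀ {n} → SimpleGraph n → Subset n → Set
Independent G A = ∀ u v → Adj G u v ≡ true → u ∈ A → v ∈ A → ⊥

edgeIndicator : ∀ {n} → SimpleGraph n → Subset n → Fin n → Fin n → ℕ
edgeIndicator G A u v = if does (u <? v) ∧ Adj G u v ∧ mem u A ∧ mem v A then 1 else 0

edgeCount≡sum-tabulate : ∀ {n} (G : SimpleGraph n) (A : Subset n) →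
                         edgeCount G A ≡ sum (tabulate λ u → sum (tabulate (edgeIndicator G A u)))
edgeCount≡sum-tabulate {n} G A = cong sum (begin
  map (λ u → sum (map (edgeIndicator G A u) (allFin n))) (allFin n)
    ≡⟨ map-tabulate (λ u → u) _ ⟩
  tabulate (λ u → sum (map (edgeIndicator G A u) (allFin n)))
    ≡⟨ tabulate-cong (λ u → cong sum (map-tabulate (λ v → v) (edgeIndicator G A u))) ⟩
  tabulate (λ u → sum (tabulate (edgeIndicator G A u))) ∎)
  where open ≡-Reasoning

edgeCount≡0⇒edgeIndicator≡0 : ∀ {n} (G : SimpleGraph n) (A : Subset n) → edgeCount G A ≡ 0 →
                              ∀ u v → edgeIndicator G A u v ≡ 0
edgeCount≡0⇒edgeIndicator≡0 G A #E≡0 u =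
  sum-tabulate≡0⁻ (edgeIndicator G A u)
    (sum-tabulate≡0⁻ (λ u → sum (tabulate (edgeIndicator G A u)))
      (trans (sym (edgeCount≡sum-tabulate G A)) #E≡0) u)

edgeIndicator≡0⇒edgeCount≡0 : ∀ {n} (G : SimpleGraph n) (A : Subset n) →
                              (∀ u v → edgeIndicator G A u v ≡ 0) → edgeCount G A ≡ 0
edgeIndicator≡0⇒edgeCount≡0 G A ind≡0 =
  trans (edgeCount≡sum-tabulate G A)
    (sum-tabulate≡0⁺ _ λ u → sum-tabulate≡0⁺ (edgeIndicator G A u) (ind≡0 u))

edgeIndicator≡0⇒nonedge : ∀ {n} (G : SimpleGraph n) (A : Subset n) {u v} → edgeIndicator G A u v ≡ 0 →
                          u <ᶠ v → Adj G u v ≡ true → u ∈ A → v ∈ A → ⊥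
edgeIndicator≡0⇒nonedge G A {u} {v} ind≡0 u<v uv∈E u∈A v∈A
  rewrite dec-true (u <? v) u<v | uv∈E | ∈⇒mem≡true u∈A | ∈⇒mem≡true v∈A with ind≡0
... | ()

edgeCount≡0⇒independent : ∀ {n} (G : SimpleGraph n) (A : Subset n) → edgeCount G A ≡ 0 → Independent G A
edgeCount≡0⇒independent G A #E≡0 u v uv∈E u∈A v∈A with <-cmp u v
... | tri< u<v _ _ =
  edgeIndicator≡0⇒nonedge G A (edgeCount≡0⇒edgeIndicator≡0 G A #E≡0 u v) u<v uv∈E u∈A v∈A
... | tri> _ _ v<u =
  edgeIndicator≡0⇒nonedge G A (edgeCount≡0⇒edgeIndicator≡0 G A #E≡0 v u) v<u
    (trans (Adj-sym G v u) uv∈E) v∈A u∈A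
... | tri≈ _ refl _ with trans (sym uv∈E) (irrefl G u)
... | ()

independent⇒edgeCount≡0 : ∀ {n} (G : SimpleGraph n) (A : Subset n) → Independent G A → edgeCount G A ≡ 0
independent⇒edgeCount≡0 G A indep = edgeIndicator≡0⇒edgeCount≡0 G A indicator≡0
  where
  indicator≡0 : ∀ u v → edgeIndicator G A u v ≡ 0
  indicator≡0 u v with does (u <? v) | Adj G u v in uv∈E | mem u A in u∈A | mem v A in v∈A
  ... | false | _     | _     | _     = refl
  ... | true  | false | _     | _     = refl
  ... | true  | true  | false | _     = refl
  ... | true  | true  | true  | false = refl
  ... | true  | true  | true  | true  = ⊥-elim (indep u v uv∈E (mem≡true⇒∈ A u∈A) (mem≡true⇒∈ A v∈A))

identity-colourable : ∀ {n} (G : SimpleGraph n) → Colourable G n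
identity-colourable G = (λ v → v) , λ { u .u uu∈E refl → absurd (trans (sym uu∈E) (irrefl G u)) }
  where
  absurd : true ≡ false → ⊥
  absurd ()

rank : ∀ {m} (w : Fin m → ℕ) (i : Fin m) → w i ≢ 0 → Fin (sum (tabulate (sgn ∘ w)))
rank w zero wᵢ≢0 with w zero
... | zero  = ⊥-elim (wᵢ≢0 refl)
... | suc _ = zero
rank w (suc i) wᵢ≢0 with w zero
... | zero  = rank (w ∘ suc) i wᵢ≢0
... | suc _ = suc (rank (w ∘ suc) i wᵢ≢0)

rank-injective : ∀ {m} (w : Fin m → ℕ) {i j : Fin m} (wᵢ≢0 : w i ≢ 0) (wⱼ≢0 : w j ≢ 0) →
                 rank w i wᵢ≢0 ≡ rank w j wⱼ≢0 → i ≡ j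
rank-injective w {zero}  {zero}  _    _    _ = refl
rank-injective w {zero}  {suc j} wᵢ≢0 wⱼ≢0 eq with w zero
rank-injective w {zero}  {suc j} wᵢ≢0 wⱼ≢0 _  | zero  = ⊥-elim (wᵢ≢0 refl)
rank-injective w {zero}  {suc j} wᵢ≢0 wⱼ≢0 () | suc _
rank-injective w {suc i} {zero}  wᵢ≢0 wⱼ≢0 eq with w zero
rank-injective w {suc i} {zero}  wᵢ≢0 wⱼ≢0 _  | zero  = ⊥-elim (wⱼ≢0 refl)
rank-injective w {suc i} {zero}  wᵢ≢0 wⱼ≢0 () | suc _
rank-injective w {suc i} {suc j} wᵢ≢0 wⱼ≢0 eq with w zero
... | zero  = cong suc (rank-injective (w ∘ suc) wᵢ≢0 wⱼ≢0 eq)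
... | suc _ = cong suc (rank-injective (w ∘ suc) wᵢ≢0 wⱼ≢0 (suc-injective eq))

colourable-by-weighted-colours : ∀ {n m} (G : SimpleGraph n) (c : Fin n → Fin m) →
                                 IsProperColouring G m c → (w : Fin m → ℕ) → (∀ v → w (c v) ≢ 0) →
                                 Colourable G (sum (tabulate (sgn ∘ w)))
colourable-by-weighted-colours G c proper w used =
  (λ v → rank w (c v) (used v)) , λ u v uv∈E eq → proper u v uv∈E (rank-injective w (used u) (used v) eq)

independent-cover⇒colourable : ∀ {n m} (G : SimpleGraph n) (A : Fin m → Subset n) →
                               (∀ i → Independent G (A i)) → (∀ v → v ∈ ⋃ (tabulate A)) →
                               Colourable G (sum (tabulate (λ i → sgn ∣ A i ∣)))
independent-cover⇒colourable {n} {m} G A indep cover =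
  colourable-by-weighted-colours G class proper (λ i → ∣ A i ∣) (λ v → ∈⇒∣p∣≢0 (∈class v))
  where
  class : Fin n → Fin m
  class v = proj₁ (∈⋃⁻ A (cover v))
  ∈class : ∀ v → v ∈ A (class v)
  ∈class v = proj₂ (∈⋃⁻ A (cover v))
  proper : IsProperColouring G m class
  proper u v uv∈E eq = indep (class u) u v uv∈E (∈class u) (subst (λ i → v ∈ A i) (sym eq) (∈class v))

colourClass : ∀ {n m} → (Fin n → Fin m) → Fin m → Subset n
colourClass c i = Vec.tabulate (λ v → does (c v ≟ᶠ i))

∈colourClass⁺ : ∀ {n m} (c : Fin n → Fin m) {v i} → c v ≡ i → v ∈ colourClass c i
∈colourClass⁺ c {v} {i} cv≡i =
  lookup⇒[]= v (colourClass c i) (trans (lookup∘tabulate _ v) (dec-true (c v ≟ᶠ i) cv≡i))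

∈colourClass⁻ : ∀ {n m} (c : Fin n → Fin m) {v i} → v ∈ colourClass c i → c v ≡ i
∈colourClass⁻ c {v} {i} v∈
  with c v ≟ᶠ i | trans (sym (lookup∘tabulate (λ v → does (c v ≟ᶠ i)) v)) ([]=⇒lookup v∈)
... | yes cv≡i | _ = cv≡i
... | no _     | ()

colourClass-independent : ∀ {n m} (G : SimpleGraph n) (c : Fin n → Fin m) → IsProperColouring G m c →
                          ∀ i → Independent G (colourClass c i)
colourClass-independent G c proper i u v uv∈E u∈ v∈ =
  proper u v uv∈E (trans (∈colourClass⁻ c u∈) (sym (∈colourClass⁻ c v∈)))

colourClass-cover : ∀ {n m} (c : Fin n → Fin m) v → v ∈ ⋃ (tabulate (colourClass c))
colourClass-cover c v = ∈⋃⁺ (colourClass c) (c v) (∈colourClass⁺ c refl)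

∣colourClass∣≡0 : ∀ {n m} (c : Fin n → Fin m) {i} → (∀ v → c v ≢ i) → ∣ colourClass c i ∣ ≡ 0
∣colourClass∣≡0 {n} c c≢i =
  trans (cong ∣_∣ (Empty-unique λ { (v , v∈) → c≢i v (∈colourClass⁻ c v∈) })) (∣⊥∣≡0 n)

sum-sgn-∣colourClass∣-≤ : ∀ {n k m} (c : Fin n → Fin k) (k≤m : k ≤ m) →
                          sum (tabulate (λ i → sgn ∣ colourClass (λ v → inject≤ (c v) k≤m) i ∣)) ≤ k
sum-sgn-∣colourClass∣-≤ {k = k} c k≤m = sum-tabulate-≤ k _ (λ i → sgn≤1 _) unused
  where
  unused : ∀ i → k ≤ toℕ i → sgn ∣ colourClass (λ v → inject≤ (c v) k≤m) i ∣ ≡ 0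
  unused i k≤i = cong sgn (∣colourClass∣≡0 _ λ v cv≡i →
    <⇒≱ (subst (_< k) (trans (sym (toℕ-inject≤ (c v) k≤m)) (cong toℕ cv≡i)) (toℕ<n (c v))) k≤i)

objective≡sum-sgn : ∀ {n} (G : SimpleGraph n) (A : Fin n → Subset n) →
                    (∀ i → Independent G (A i)) → (∀ v → v ∈ ⋃ (tabulate A)) →
                    objective G A ≡ sum (tabulate (λ i → sgn ∣ A i ∣))
objective≡sum-sgn {n} G A indep cover = begin
  n * sum (tabulate (λ i → edgeCount G (A i))) + S + n * (n ∸ ∣ ⋃ (tabulate A) ∣)
    ≡⟨ cong₂ (λ E D → n * E + S + n * D)
             (sum-tabulate≡0⁺ _ λ i → independent⇒edgeCount≡0 G (A i) (indep i))
             (∈⇒n∸∣p∣≡0 _ cover) ⟩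
  n * 0 + S + n * 0
    ≡⟨ n*0+S+n*0≡S n S ⟩
  S ∎
  where
  open ≡-Reasoning
  S = sum (tabulate (λ i → sgn ∣ A i ∣))

chromaticNumber≤n : ∀ {n} (G : SimpleGraph n) {γ} → IsChromaticNumber G γ → γ ≤ n
chromaticNumber≤n {n} G (_ , minimal) = minimal n (identity-colourable G)

chromaticNumber≤objective : ∀ {n} (G : SimpleGraph n) {γ} → IsChromaticNumber G γ →
                            (A : Fin n → Subset n) → γ ≤ objective G A
chromaticNumber≤objective {n} G χ@(_ , minimal) A =
  k≤n*E+S+n*D n _ _ _ (chromaticNumber≤n G χ) λ E≡0 D≡0 →
    minimal _ (independent-cover⇒colourable G A
      (λ i → edgeCount≡0⇒independent G (A i) (sum-tabulate≡0⁻ _ E≡0 i))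
      (n∸∣p∣≡0⇒∈ _ D≡0))

proposition4p10 : (n : ℕ) (G : SimpleGraph n) (γ : ℕ) → IsChromaticNumber G γ → IsMinObjective G γ
proposition4p10 n G γ χ@((c , proper) , _) =
  (classes , ≤-antisym classes≤γ (chromaticNumber≤objective G χ classes)) , chromaticNumber≤objective G χ
  where
  γ≤n : γ ≤ n
  γ≤n = chromaticNumber≤n G χ
  c′ : Fin n → Fin n
  c′ v = inject≤ (c v) γ≤n
  proper′ : IsProperColouring G n c′
  proper′ u v uv∈E eq = proper u v uv∈E (inject≤-injective γ≤n γ≤n (c u) (c v) eq)
  classes : Fin n → Subset n
  classes = colourClass c′
  classes≤γ : objective G classes ≤ γ
  classes≤γ = begin
    objective G classes
      ≡⟨ objective≡sum-sgn G classes (colourClass-independent G c′ proper′) (colourClass-cover c′) ⟩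
    sum (tabulate (λ i → sgn ∣ classes i ∣))
      ≤⟨ sum-sgn-∣colourClass∣-≤ c γ≤n ⟩
    γ ∎
    where open ≤-Reasoning
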